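{- Let $f$ be a function from the positive integers to the integers, and let $M,N$ be positive integers. Then, for either choice of sign (the same on both sides of each identity), \[ \sum_{i=1}^{2N}\frac{(\pm1)^i q^{f(i)}\,u_{f(i+2M)-f(i)}\,u_{f(i+2M)+f(i)}}{u_{f(i)}^2\,u_{f(i+2M)}^2}=\sum_{i=1}^{2M}\frac{(\pm1)^i q^{f(i)}\,u_{f(i+2N)-f(i)}\,u_{f(i+2N)+f(i)}}{u_{f(i)}^2\,u_{f(i+2N)}^2}, \] \[ \sum_{i=1}^{2N}\frac{(\pm1)^i q^{f(i)}\,u_{f(i+2M)-f(i)}\,u_{f(i+2M)+f(i)}}{v_{f(i)}^2\,v_{f(i+2M)}^2}=\sum_{i=1}^{2M}\frac{(\pm1)^i q^{f(i)}\,u_{f(i+2N)-f(i)}\,u_{f(i+2N)+f(i)}}{v_{f(i)}^2\,v_{f(i+2N)}^2}. \]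
   Context: Let $p,q$ be complex numbers. The Lucas sequences $u_n=u_n(p,q)$ and $v_n=v_n(p,q)$ are defined by $u_0=0$, $u_1=1$, $v_0=2$, $v_1=p$, and $x_n=px_{n-1}-qx_{n-2}$ for $x\in\{u,v\}$. Let $\alpha,\beta$ be the roots of $x^2-px+q=0$, labeled so that $|\alpha|>|\beta|$, with discriminant $D=p^2-4q\neq0$; thus $\alpha+\beta=p$, $\alpha\beta=q$, $\alpha-\beta=\sqrt D$, and $u_n=(\alpha^n-\beta^n)/(\alpha-\beta)$, $v_n=\alpha^n+\beta^n$. These Binet formulas also define $u_n,v_n$ for negative integers $n$ (with $q\neq0$ understood whenever negative indices occur). As implicit in the statement, all denominators appearing are assumed nonzero. -}

module Defs where

open import Level using (Level; _⊔_) renaming (suc to lsuc)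
open import Algebra.Bundles using (CommutativeRing)
open import Data.Nat as ℕ using (ℕ; zero; suc)
open import Data.Integer as ℤ using (ℤ; +_; -[1+_])
open import Data.Bool using (Bool; true; false)
open import Data.Product using (_×_)
open import Relation.Nullary using (¬_)

-- The inverse is a total operation whose value at 0 is
-- unconstrained (it is only ever used at nonzero arguments).
record Field (c ℓ : Level) : Set (lsuc (c ⊔ ℓ)) where
  field
    commutativeRing : CommutativeRing c ℓ
  open CommutativeRing commutativeRing public
  field
    _⁻¹        : Carrier → Carrier
    ⁻¹-inverse : ∀ x → ¬ (x ≈ 0#) → (x * (x ⁻¹)) ≈ 1#
    0≉1        : ¬ (0# ≈ 1#)

module Lucas {c ℓ : Level} (F : Field c ℓ) (p q : Field.Carrier F) where
  open Field F

  infixl 7 _/_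
  _/_ : Carrier → Carrier → Carrier
  x / y = x * (y ⁻¹)

  powℕ : Carrier → ℕ → Carrier
  powℕ x zero    = 1#
  powℕ x (suc n) = x * powℕ x n

  powℤ : Carrier → ℤ → Carrier
  powℤ x (+ n)     = powℕ x n
  powℤ x -[1+ n ]  = powℕ (x ⁻¹) (suc n)

  sq : Carrier → Carrier
  sq x = x * x

  D : Carrier
  D = p * p - (1# + 1# + 1# + 1#) * q

  uℕ : ℕ → Carrier
  uℕ zero          = 0#
  uℕ (suc zero)    = 1#
  uℕ (suc (suc n)) = p * uℕ (suc n) - q * uℕ n

  vℕ : ℕ → Carrier
  vℕ zero          = 1# + 1#
  vℕ (suc zero)    = p
  vℕ (suc (suc n)) = p * vℕ (suc n) - q * vℕ n

  -- negative indices, as given by the Binet formulas: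
  -- u_{-n} = - u_n / q^n ,  v_{-n} = v_n / q^n
  u : ℤ → Carrier
  u (+ n)    = uℕ n
  u -[1+ n ] = - (uℕ (suc n) / powℕ q (suc n))

  v : ℤ → Carrier
  v (+ n)    = vℕ n
  v -[1+ n ] = vℕ (suc n) / powℕ q (suc n)

  sign : Bool → Carrier
  sign true  = 1#
  sign false = - 1#

  Σ1 : ℕ → (ℕ → Carrier) → Carrier
  Σ1 zero    g = 0#
  Σ1 (suc n) g = Σ1 n g + g (suc n)

  den : (ℤ → Carrier) → (ℕ → ℤ) → ℕ → ℕ → Carrier
  den w f K i = sq (w (f i)) * sq (w (f (i ℕ.+ K)))

  term : (ℤ → Carrier) → Bool → (ℕ → ℤ) → ℕ → ℕ → Carrier
  term w s f K i =
    powℕ (sign s) i * powℤ q (f i)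
      * u (f (i ℕ.+ K) ℤ.- f i) * u (f (i ℕ.+ K) ℤ.+ f i)
      / den w f K i

  DenomsNonzero : (ℤ → Carrier) → (ℕ → ℤ) → ℕ → ℕ → Set ℓ
  DenomsNonzero w f K n = ∀ i → 1 ℕ.≤ i → i ℕ.≤ n → ¬ (den w f K i ≈ 0#)

-- all indices occurring in Σ_{i=1}^{n} term w s f K i are nonnegative:
-- 0 ≤ f(i) ≤ f(i+K) for 1 ≤ i ≤ n
NonnegIndices : (ℕ → ℤ) → ℕ → ℕ → Set
NonnegIndices f K n = ∀ i → 1 ℕ.≤ i → i ℕ.≤ n → (+ 0 ℤ.≤ f i) × (f i ℤ.≤ f (i ℕ.+ K))

-- With G(z) = q^z / w_z² for w ∈ {u, v}, every summand is (±1)^i κ⁻¹ (G(f(i)) − G(f(i+K))),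
-- where κ = 1 for u and κ = D for v.  This is the Catalan-type identity
--   q^a w_b² − q^b w_a² = κ q^a u_{b−a} u_{b+a},
-- which for 0 ≤ a ≤ b is the case n = b − a, i = j = a of
--   w_{n+i} w_{n+j} − q^n w_i w_j = κ u_n u_{n+i+j}
-- (for v reduced to u through v_n = 2u_{n+1} − p u_n), and which extends to all integers
-- when q ≠ 0 because u_{−n} = −q^{−n} u_n and v_{−n} = q^{−n} v_n.  Since (±1)^i has
-- periods 2M and 2N, both sides telescope to S(2M) + S(2N) − S(2M + 2N), where
-- S(n) = Σ_{i=1}^{n} (±1)^i κ⁻¹ G(f(i)).
module Submission where

open import Defs
open import Level using (_⊔_)
open import Data.Nat as ℕ using (ℕ; zero; suc; _≤_) renaming (_*_ to _*ℕ_)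
import Data.Nat.Properties as ℕP
open import Data.Integer as ℤ using (ℤ; +_; -[1+_])
import Data.Integer.Properties as ℤP
import Data.Integer.Tactic.RingSolver as ℤ-Solver
open import Data.Sign as Sign using (Sign)
open import Data.Maybe using (Maybe; just; nothing)
open import Data.Bool using (Bool; true; false)
open import Data.Product using (_×_; _,_; proj₁; proj₂)
open import Data.Sum as Sum using (_⊎_; inj₁; inj₂)
open import Relation.Nullary using (¬_; yes; no)
open import Relation.Binary.PropositionalEquality as ≡ using (_≡_)
open import Algebra.Bundles using (CommutativeRing)
open import Algebra.Solver.Ring.AlmostCommutativeRing
  using (fromCommutativeRing; _-Raw-AlmostCommutative⟶_)

+[m+n]-+m≡+n : ∀ m n → + (m ℕ.+ n) ℤ.- + m ≡ + n
+[m+n]-+m≡+n m n = ≡.trans (≡.cong (ℤ._- + m) (ℤP.pos-+ m n)) (i+j-i≡j (+ m) (+ n))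
  where
  i+j-i≡j : ∀ i j → i ℤ.+ j ℤ.- i ≡ j
  i+j-i≡j = ℤ-Solver.solve-∀

module _ {c ℓ} (F : Field c ℓ) where
  open Field F
  open import Relation.Binary.Reasoning.Setoid setoid
  open import Algebra.Properties.Ring ring using (-0#≈0#; -‿+-comm; -‿involutive; -‿distribˡ-*)
  open import Algebra.Properties.CommutativeSemigroup +-commutativeSemigroup
    using () renaming (interchange to +-interchange)
  open import Algebra.Properties.CommutativeSemigroup *-commutativeSemigroup
    using () renaming (interchange to *-interchange)
  open import Algebra.Properties.Semiring.Mult.TCOptimised semiring
    using (1+×; ×-homo-+; ×1-homo-*) renaming (_×_ to _×ᴿ_)

  -- The ring solver works with integer coefficients, read in F through ι.  The
  -- tail-optimised multiple makes ι (+ 1) definitionally 1#, so that 1# in a goal is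
  -- matched by the solver constant :1.
  ι : ℤ → Carrier
  ι (+ n)    = n ×ᴿ 1#
  ι -[1+ n ] = - (suc n ×ᴿ 1#)

  private
    σ : Sign → Carrier
    σ Sign.+ = 1#
    σ Sign.- = - 1#

    σ-* : ∀ s t → σ (s Sign.* t) ≈ σ s * σ t
    σ-* Sign.+ t       = sym (*-identityˡ _)
    σ-* Sign.- Sign.+  = sym (*-identityʳ _)
    σ-* Sign.- Sign.-  = begin
      1#            ≈⟨ -‿involutive 1# ⟨
      - - 1#        ≈⟨ -‿cong (*-identityˡ _) ⟨
      - (1# * - 1#) ≈⟨ -‿distribˡ-* 1# (- 1#) ⟩
      - 1# * - 1#   ∎

    ι-◃ : ∀ s n → ι (s ℤ.◃ n) ≈ σ s * (n ×ᴿ 1#)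
    ι-◃ s      zero    = sym (zeroʳ _)
    ι-◃ Sign.+ (suc n) = sym (*-identityˡ _)
    ι-◃ Sign.- (suc n) = trans (-‿cong (sym (*-identityˡ _))) (-‿distribˡ-* _ _)

  ι-⊖ : ∀ m n → ι (m ℤ.⊖ n) ≈ m ×ᴿ 1# - n ×ᴿ 1#
  ι-⊖ zero    zero    = sym (-‿inverseʳ 0#)
  ι-⊖ (suc m) zero    = sym (trans (+-congˡ -0#≈0#) (+-identityʳ _))
  ι-⊖ zero    (suc n) = sym (+-identityˡ _)
  ι-⊖ (suc m) (suc n) = begin
    ι (suc m ℤ.⊖ suc n)                   ≡⟨ ≡.cong ι (ℤP.[1+m]⊖[1+n]≡m⊖n m n) ⟩
    ι (m ℤ.⊖ n)                           ≈⟨ ι-⊖ m n ⟩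
    m ×ᴿ 1# - n ×ᴿ 1#                     ≈⟨ +-identityˡ _ ⟨
    0# + (m ×ᴿ 1# - n ×ᴿ 1#)              ≈⟨ +-congʳ (-‿inverseʳ 1#) ⟨
    (1# - 1#) + (m ×ᴿ 1# - n ×ᴿ 1#)       ≈⟨ +-interchange _ _ _ _ ⟩
    (1# + m ×ᴿ 1#) + (- 1# - n ×ᴿ 1#)     ≈⟨ +-cong (sym (1+× m 1#)) (trans (-‿+-comm _ _) (-‿cong (sym (1+× n 1#)))) ⟩
    suc m ×ᴿ 1# - suc n ×ᴿ 1#             ∎

  ι-+ : ∀ i j → ι (i ℤ.+ j) ≈ ι i + ι j
  ι-+ (+ m)    (+ n)    = ×-homo-+ 1# m n
  ι-+ (+ m)    -[1+ n ] = ι-⊖ m (suc n)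
  ι-+ -[1+ m ] (+ n)    = trans (ι-⊖ n (suc m)) (+-comm _ _)
  ι-+ -[1+ m ] -[1+ n ] = begin
    - (suc (suc m ℕ.+ n) ×ᴿ 1#)                ≡⟨ ≡.cong (λ k → - (suc k ×ᴿ 1#)) (≡.sym (ℕP.+-suc m n)) ⟩
    - ((suc m ℕ.+ suc n) ×ᴿ 1#)                ≈⟨ -‿cong (×-homo-+ 1# (suc m) (suc n)) ⟩
    - (suc m ×ᴿ 1# + suc n ×ᴿ 1#)              ≈⟨ -‿+-comm _ _ ⟨
    - (suc m ×ᴿ 1#) + - (suc n ×ᴿ 1#)          ∎

  ι-neg : ∀ i → ι (ℤ.- i) ≈ - ι i
  ι-neg (+ zero)  = sym -0#≈0#
  ι-neg (+ suc n) = refl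
  ι-neg -[1+ n ]  = sym (-‿involutive _)

  ι-* : ∀ i j → ι (i ℤ.* j) ≈ ι i * ι j
  ι-* i j = begin
    ι (i ℤ.* j)                                                ≈⟨ ι-◃ (ℤ.sign i Sign.* ℤ.sign j) (∣i∣ ℕ.* ∣j∣) ⟩
    σ (ℤ.sign i Sign.* ℤ.sign j) * ((∣i∣ ℕ.* ∣j∣) ×ᴿ 1#)       ≈⟨ *-cong (σ-* (ℤ.sign i) (ℤ.sign j)) (×1-homo-* ∣i∣ ∣j∣) ⟩
    σ (ℤ.sign i) * σ (ℤ.sign j) * (∣i∣ ×ᴿ 1# * ∣j∣ ×ᴿ 1#)      ≈⟨ *-interchange _ _ _ _ ⟩
    σ (ℤ.sign i) * ∣i∣ ×ᴿ 1# * (σ (ℤ.sign j) * ∣j∣ ×ᴿ 1#)      ≈⟨ *-cong (ι-sign-abs i) (ι-sign-abs j) ⟨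
    ι i * ι j                                                  ∎
    where
    ∣i∣ = ℤ.∣ i ∣
    ∣j∣ = ℤ.∣ j ∣
    ι-sign-abs : ∀ k → ι k ≈ σ (ℤ.sign k) * (ℤ.∣ k ∣ ×ᴿ 1#)
    ι-sign-abs k = trans (reflexive (≡.cong ι (≡.sym (ℤP.◃-inverse k)))) (ι-◃ (ℤ.sign k) ℤ.∣ k ∣)

  private
    ℤ-morphism : CommutativeRing.rawRing ℤP.+-*-commutativeRing
                   -Raw-AlmostCommutative⟶ fromCommutativeRing commutativeRing
    ℤ-morphism = record
      { ⟦_⟧ = ι ; +-homo = ι-+ ; *-homo = ι-* ; -‿homo = ι-neg
      ; 0-homo = refl ; 1-homo = refl }

    ι-≟ : ∀ i j → Maybe (ι i ≈ ι j)
    ι-≟ i j with i ℤ.≟ j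
    ... | yes ≡.refl = just refl
    ... | no _       = nothing

  open import Algebra.Solver.Ring _ _ ℤ-morphism ι-≟
    using (solve; Polynomial; con; _:+_; _:*_; _:-_; :-_; _:=_)

  :0 :1 : ∀ {n} → Polynomial n
  :0 = con (+ 0)
  :1 = con (+ 1)

  infixr 5 _·_∷_
  data LinearCombination : Set (c ⊔ ℓ) where
    []    : LinearCombination
    _·_∷_ : Carrier → {a b : Carrier} → a ≈ b → LinearCombination → LinearCombination

  combination : LinearCombination → Carrier
  combination []                       = 0#
  combination (_·_∷_ k {a} {b} _ rest) = k * (a - b) + combination rest

  combination≈0 : ∀ cs → combination cs ≈ 0#
  combination≈0 []             = refl
  combination≈0 (k · a≈b ∷ cs) = begin
    k * (_ - _) + combination cs ≈⟨ +-cong (*-congˡ (trans (+-congʳ a≈b) (-‿inverseʳ _))) (combination≈0 cs) ⟩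
    k * 0# + 0#                  ≈⟨ trans (+-identityʳ _) (zeroʳ k) ⟩
    0#                           ∎

  -- Most identities below are proved from a certificate: the ring solver writes the
  -- difference of the two sides as a combination Σ kᵢ (aᵢ − bᵢ) of known aᵢ ≈ bᵢ.
  linear-combination : ∀ {x y} cs → x - y ≈ combination cs → x ≈ y
  linear-combination {x} {y} cs x-y≈cs = begin
    x           ≈⟨ solve 2 (λ x y → x := (x :- y) :+ y) refl x y ⟩
    (x - y) + y ≈⟨ +-congʳ (trans x-y≈cs (combination≈0 cs)) ⟩
    0# + y      ≈⟨ +-identityˡ y ⟩
    y           ∎

  x*x⁻¹≈1 : ∀ {x} → x ≉ 0# → x * x ⁻¹ ≈ 1#
  x*x⁻¹≈1 {x} = ⁻¹-inverse x

  1≉0 : 1# ≉ 0#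
  1≉0 1≈0 = 0≉1 (sym 1≈0)

  x*y≈1⇒x≉0 : ∀ {x y} → x * y ≈ 1# → x ≉ 0#
  x*y≈1⇒x≉0 {x} {y} xy≈1 x≈0 = 0≉1 (trans (sym (trans (*-congʳ x≈0) (zeroˡ y))) xy≈1)

  x*y≉0⇒x≉0 : ∀ {x y} → x * y ≉ 0# → x ≉ 0#
  x*y≉0⇒x≉0 {x} {y} xy≉0 x≈0 = xy≉0 (trans (*-congʳ x≈0) (zeroˡ y))

  x*y≉0⇒y≉0 : ∀ {x y} → x * y ≉ 0# → y ≉ 0#
  x*y≉0⇒y≉0 {x} {y} xy≉0 y≈0 = xy≉0 (trans (*-congˡ y≈0) (zeroʳ x))

  ⁻¹-unique : ∀ {x y} → x * y ≈ 1# → y ≈ x ⁻¹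
  ⁻¹-unique {x} {y} xy≈1 = linear-combination
    (- y · x*x⁻¹≈1 (x*y≈1⇒x≉0 xy≈1) ∷ x ⁻¹ · xy≈1 ∷ [])
    (solve 3 (λ x y x' → y :- x' := (:- y) :* (x :* x' :- :1) :+ (x' :* (x :* y :- :1) :+ :0)) refl x y (x ⁻¹))

  ⁻¹-distrib-* : ∀ {x y} → x ≉ 0# → y ≉ 0# → (x * y) ⁻¹ ≈ x ⁻¹ * y ⁻¹
  ⁻¹-distrib-* {x} {y} x≉0 y≉0 = sym (⁻¹-unique (linear-combination
    (y * y ⁻¹ · x*x⁻¹≈1 x≉0 ∷ 1# · x*x⁻¹≈1 y≉0 ∷ [])
    (solve 4 (λ x y x' y' → x :* y :* (x' :* y') :- :1
                            := y :* y' :* (x :* x' :- :1) :+ (:1 :* (y :* y' :- :1) :+ :0))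
           refl x y (x ⁻¹) (y ⁻¹))))

  quotient-of-cross-difference : ∀ {κ X a b A B} → κ * X ≈ a * B - b * A → κ ≉ 0# → A * B ≉ 0# →
    X * (A * B) ⁻¹ ≈ κ ⁻¹ * (a * A ⁻¹) - κ ⁻¹ * (b * B ⁻¹)
  quotient-of-cross-difference {κ} {X} {a} {b} {A} {B} κX≈ κ≉0 AB≉0 = linear-combination
    ( X · ⁻¹-distrib-* A≉0 B≉0
    ∷ κ ⁻¹ * A ⁻¹ * B ⁻¹ · κX≈
    ∷ - (X * A ⁻¹ * B ⁻¹) · x*x⁻¹≈1 κ≉0
    ∷ κ ⁻¹ * a * A ⁻¹ · x*x⁻¹≈1 B≉0
    ∷ - (κ ⁻¹ * b * B ⁻¹) · x*x⁻¹≈1 A≉0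
    ∷ [])
    (solve 10 (λ κ κ' X a b A A' B B' I →
        X :* I :- (κ' :* (a :* A') :- κ' :* (b :* B'))
        := X :* (I :- A' :* B') :+ (κ' :* A' :* B' :* (κ :* X :- (a :* B :- b :* A))
           :+ ((:- (X :* A' :* B')) :* (κ :* κ' :- :1) :+ (κ' :* a :* A' :* (B :* B' :- :1)
           :+ ((:- (κ' :* b :* B')) :* (A :* A' :- :1) :+ :0)))))
      refl κ (κ ⁻¹) X a b A (A ⁻¹) B (B ⁻¹) ((A * B) ⁻¹))
    where
    A≉0 = x*y≉0⇒x≉0 AB≉0
    B≉0 = x*y≉0⇒y≉0 AB≉0

  module _ (p q : Carrier) where
    open Lucas F p q

    pow-+ : ∀ x m n → powℕ x (m ℕ.+ n) ≈ powℕ x m * powℕ x n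
    pow-+ x zero    n = sym (*-identityˡ _)
    pow-+ x (suc m) n = trans (*-congˡ (pow-+ x m n)) (sym (*-assoc _ _ _))

    pow*pow⁻¹≈1 : ∀ {x} → x ≉ 0# → ∀ n → powℕ x n * powℕ (x ⁻¹) n ≈ 1#
    pow*pow⁻¹≈1 x≉0 zero    = *-identityˡ 1#
    pow*pow⁻¹≈1 {x} x≉0 (suc n) = linear-combination
      (powℕ x n * powℕ (x ⁻¹) n · x*x⁻¹≈1 x≉0 ∷ 1# · pow*pow⁻¹≈1 x≉0 n ∷ [])
      (solve 4 (λ x x' xⁿ x'ⁿ → x :* xⁿ :* (x' :* x'ⁿ) :- :1
                                := xⁿ :* x'ⁿ :* (x :* x' :- :1) :+ (:1 :* (xⁿ :* x'ⁿ :- :1) :+ :0))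
             refl x (x ⁻¹) (powℕ x n) (powℕ (x ⁻¹) n))

    pow-⁻¹ : ∀ {x} → x ≉ 0# → ∀ n → powℕ (x ⁻¹) n ≈ powℕ x n ⁻¹
    pow-⁻¹ x≉0 n = ⁻¹-unique (pow*pow⁻¹≈1 x≉0 n)

    pow-≉0 : ∀ {x} → x ≉ 0# → ∀ n → powℕ x n ≉ 0#
    pow-≉0 x≉0 n = x*y≈1⇒x≉0 (pow*pow⁻¹≈1 x≉0 n)

    powℤ-⊖ : ∀ {x} → x ≉ 0# → ∀ m n → powℤ x (m ℤ.⊖ n) ≈ powℕ x m * powℕ (x ⁻¹) n
    powℤ-⊖ x≉0 zero    zero    = sym (*-identityˡ 1#)
    powℤ-⊖ x≉0 (suc m) zero    = sym (*-identityʳ _)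
    powℤ-⊖ x≉0 zero    (suc n) = sym (*-identityˡ _)
    powℤ-⊖ {x} x≉0 (suc m) (suc n) = begin
      powℤ x (suc m ℤ.⊖ suc n)             ≡⟨ ≡.cong (powℤ x) (ℤP.[1+m]⊖[1+n]≡m⊖n m n) ⟩
      powℤ x (m ℤ.⊖ n)                     ≈⟨ powℤ-⊖ x≉0 m n ⟩
      powℕ x m * powℕ (x ⁻¹) n             ≈⟨ insert-x*x⁻¹ ⟩
      powℕ x (suc m) * powℕ (x ⁻¹) (suc n) ∎
      where
      insert-x*x⁻¹ : powℕ x m * powℕ (x ⁻¹) n ≈ powℕ x (suc m) * powℕ (x ⁻¹) (suc n)
      insert-x*x⁻¹ = linear-combination
        (- (powℕ x m * powℕ (x ⁻¹) n) · x*x⁻¹≈1 x≉0 ∷ [])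
        (solve 4 (λ x x' xᵐ x'ⁿ → xᵐ :* x'ⁿ :- x :* xᵐ :* (x' :* x'ⁿ) := (:- (xᵐ :* x'ⁿ)) :* (x :* x' :- :1) :+ :0)
          refl x (x ⁻¹) (powℕ x m) (powℕ (x ⁻¹) n))

    powℤ-+ : ∀ {x} → x ≉ 0# → ∀ i j → powℤ x (i ℤ.+ j) ≈ powℤ x i * powℤ x j
    powℤ-+ {x} x≉0 (+ m)    (+ n)    = pow-+ x m n
    powℤ-+ {x} x≉0 (+ m)    -[1+ n ] = powℤ-⊖ x≉0 m (suc n)
    powℤ-+ {x} x≉0 -[1+ m ] (+ n)    = trans (powℤ-⊖ x≉0 n (suc m)) (*-comm _ _)
    powℤ-+ {x} x≉0 -[1+ m ] -[1+ n ] = begin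
      powℕ (x ⁻¹) (suc (suc m ℕ.+ n))                ≡⟨ ≡.cong (λ k → powℕ (x ⁻¹) (suc k)) (≡.sym (ℕP.+-suc m n)) ⟩
      powℕ (x ⁻¹) (suc m ℕ.+ suc n)                  ≈⟨ pow-+ (x ⁻¹) (suc m) (suc n) ⟩
      powℕ (x ⁻¹) (suc m) * powℕ (x ⁻¹) (suc n)      ∎

    powℤ-inverseˡ : ∀ {x} → x ≉ 0# → ∀ z → powℤ x (ℤ.- z) * powℤ x z ≈ 1#
    powℤ-inverseˡ {x} x≉0 z = begin
      powℤ x (ℤ.- z) * powℤ x z ≈⟨ powℤ-+ x≉0 (ℤ.- z) z ⟨
      powℤ x (ℤ.- z ℤ.+ z)      ≡⟨ ≡.cong (powℤ x) (ℤP.+-inverseˡ z) ⟩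
      1#                        ∎

    Σ1-cong : ∀ n {g h : ℕ → Carrier} → (∀ i → 1 ℕ.≤ i → i ℕ.≤ n → g i ≈ h i) → Σ1 n g ≈ Σ1 n h
    Σ1-cong zero    g≈h = refl
    Σ1-cong (suc n) g≈h =
      +-cong (Σ1-cong n (λ i 1≤i i≤n → g≈h i 1≤i (ℕP.m≤n⇒m≤1+n i≤n))) (g≈h (suc n) (ℕ.s≤s ℕ.z≤n) ℕP.≤-refl)

    module _ (c g : ℕ → Carrier) where

      private
        S : ℕ → Carrier
        S n = Σ1 n (λ i → c i * g i)

      Σ1-telescope : ∀ m → (∀ i → c (i ℕ.+ m) ≈ c i) → ∀ n →
        Σ1 n (λ i → c i * (g i - g (i ℕ.+ m))) ≈ S n + S m - S (n ℕ.+ m)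
      Σ1-telescope m periodic zero    = solve 1 (λ Sₘ → :0 := :0 :+ Sₘ :- Sₘ) refl (S m)
      Σ1-telescope m periodic (suc n) = linear-combination
        (1# · Σ1-telescope m periodic n ∷ g (suc n ℕ.+ m) · periodic (suc n) ∷ [])
        (solve 8 (λ L Sₙ Sₘ Sₙₘ c₁ cₘ g₁ gₘ →
            L :+ c₁ :* (g₁ :- gₘ) :- (Sₙ :+ c₁ :* g₁ :+ Sₘ :- (Sₙₘ :+ cₘ :* gₘ))
            := :1 :* (L :- (Sₙ :+ Sₘ :- Sₙₘ)) :+ (gₘ :* (cₘ :- c₁) :+ :0))
          refl (Σ1 n (λ i → c i * (g i - g (i ℕ.+ m)))) (S n) (S m) (S (n ℕ.+ m))
               (c (suc n)) (c (suc n ℕ.+ m)) (g (suc n)) (g (suc n ℕ.+ m)))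

      Σ1-swap : ∀ m n → (∀ i → c (i ℕ.+ m) ≈ c i) → (∀ i → c (i ℕ.+ n) ≈ c i) →
        Σ1 n (λ i → c i * (g i - g (i ℕ.+ m))) ≈ Σ1 m (λ i → c i * (g i - g (i ℕ.+ n)))
      Σ1-swap m n periodic-m periodic-n = begin
        Σ1 n (λ i → c i * (g i - g (i ℕ.+ m))) ≈⟨ Σ1-telescope m periodic-m n ⟩
        S n + S m - S (n ℕ.+ m)                 ≡⟨ ≡.cong (λ k → S n + S m - S k) (ℕP.+-comm n m) ⟩
        S n + S m - S (m ℕ.+ n)                 ≈⟨ +-congʳ (+-comm (S n) (S m)) ⟩
        S m + S n - S (m ℕ.+ n)                 ≈⟨ Σ1-telescope n periodic-n m ⟨
        Σ1 m (λ i → c i * (g i - g (i ℕ.+ n))) ∎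

    sign²≈1 : ∀ s → sign s * sign s ≈ 1#
    sign²≈1 true  = *-identityˡ 1#
    sign²≈1 false = solve 0 ((:- :1) :* (:- :1) := :1) refl

    pow-even : ∀ {x} → x * x ≈ 1# → ∀ M → powℕ x (2 ℕ.* M) ≈ 1#
    pow-even x²≈1 zero        = refl
    pow-even {x} x²≈1 (suc M) = begin
      powℕ x (2 ℕ.* suc M)        ≡⟨ ≡.cong (powℕ x) (ℕP.*-suc 2 M) ⟩
      x * (x * powℕ x (2 ℕ.* M))  ≈⟨ *-congˡ (*-congˡ (pow-even x²≈1 M)) ⟩
      x * (x * 1#)                ≈⟨ trans (*-congˡ (*-identityʳ x)) x²≈1 ⟩
      1#                          ∎

    sign-periodic : ∀ s M i → powℕ (sign s) (i ℕ.+ 2 ℕ.* M) ≈ powℕ (sign s) i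
    sign-periodic s M i = begin
      powℕ (sign s) (i ℕ.+ 2 ℕ.* M)            ≈⟨ pow-+ (sign s) i (2 ℕ.* M) ⟩
      powℕ (sign s) i * powℕ (sign s) (2 ℕ.* M) ≈⟨ *-congˡ (pow-even (sign²≈1 s) M) ⟩
      powℕ (sign s) i * 1#                      ≈⟨ *-identityʳ _ ⟩
      powℕ (sign s) i                           ∎

    uℕ-add : ∀ i j → uℕ (suc i) * uℕ (suc j) - q * (uℕ i * uℕ j) ≈ uℕ (suc (i ℕ.+ j))
    uℕ-add zero          j = solve 3 (λ q uⱼ uⱼ₊₁ → :1 :* uⱼ₊₁ :- q :* (:0 :* uⱼ) := uⱼ₊₁) refl q (uℕ j) (uℕ (suc j))
    uℕ-add (suc zero)    j = solve 4 (λ p q uⱼ uⱼ₊₁ → (p :* :1 :- q :* :0) :* uⱼ₊₁ :- q :* (:1 :* uⱼ)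
                                                      := p :* uⱼ₊₁ :- q :* uⱼ)
                                    refl p q (uℕ j) (uℕ (suc j))
    uℕ-add (suc (suc i)) j = linear-combination
      (p · uℕ-add (suc i) j ∷ - q · uℕ-add i j ∷ [])
      (solve 8 (λ p q uᵢ uᵢ₊₁ uⱼ uⱼ₊₁ s s₁ →
          (p :* (p :* uᵢ₊₁ :- q :* uᵢ) :- q :* uᵢ₊₁) :* uⱼ₊₁ :- q :* ((p :* uᵢ₊₁ :- q :* uᵢ) :* uⱼ)
            :- (p :* s₁ :- q :* s)
          := p :* ((p :* uᵢ₊₁ :- q :* uᵢ) :* uⱼ₊₁ :- q :* (uᵢ₊₁ :* uⱼ) :- s₁)
             :+ ((:- q) :* (uᵢ₊₁ :* uⱼ₊₁ :- q :* (uᵢ :* uⱼ) :- s) :+ :0))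
        refl p q (uℕ i) (uℕ (suc i)) (uℕ j) (uℕ (suc j)) (uℕ (suc (i ℕ.+ j))) (uℕ (suc (suc (i ℕ.+ j)))))

    ProductFormula : (ℕ → Carrier) → Carrier → Set ℓ
    ProductFormula w κ = ∀ n i j →
      w (i ℕ.+ n) * w (j ℕ.+ n) - powℕ q n * (w i * w j) ≈ κ * (uℕ n * uℕ (i ℕ.+ j ℕ.+ n))

    private
      reindex : ∀ {x κ k k′} n → k ≡ k′ → x ≈ κ * (uℕ n * uℕ k) → x ≈ κ * (uℕ n * uℕ k′)
      reindex n ≡.refl x≈ = x≈

    uℕ-product : ProductFormula uℕ 1#
    uℕ-product zero i j
      rewrite ℕP.+-identityʳ i | ℕP.+-identityʳ j | ℕP.+-identityʳ (i ℕ.+ j) =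
      solve 3 (λ uᵢ uⱼ uᵢ₊ⱼ → uᵢ :* uⱼ :- :1 :* (uᵢ :* uⱼ) := :1 :* (:0 :* uᵢ₊ⱼ)) refl (uℕ i) (uℕ j) (uℕ (i ℕ.+ j))
    uℕ-product (suc n) i j
      rewrite ℕP.+-suc i n | ℕP.+-suc j n | ℕP.+-suc (i ℕ.+ j) n = linear-combination
      ( 1# · reindex n (≡.cong (λ k → suc (k ℕ.+ n)) (ℕP.+-suc i j)) (uℕ-product n (suc i) (suc j))
      ∷ - 1# · uℕ-product n 1 (suc (i ℕ.+ j))
      ∷ powℕ q n · uℕ-add i j
      ∷ [])
      (solve 13 (λ q qⁿ uₙ uₙ₊₁ uᵢ uᵢ₊₁ uⱼ uⱼ₊₁ s a b w₁ w₂ →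
          a :* b :- q :* qⁿ :* (uᵢ :* uⱼ) :- :1 :* (uₙ₊₁ :* w₁)
          := :1 :* (a :* b :- qⁿ :* (uᵢ₊₁ :* uⱼ₊₁) :- :1 :* (uₙ :* w₂))
             :+ ((:- :1) :* (uₙ₊₁ :* w₁ :- qⁿ :* (:1 :* s) :- :1 :* (uₙ :* w₂))
             :+ (qⁿ :* (uᵢ₊₁ :* uⱼ₊₁ :- q :* (uᵢ :* uⱼ) :- s) :+ :0)))
        refl q (powℕ q n) (uℕ n) (uℕ (suc n)) (uℕ i) (uℕ (suc i)) (uℕ j) (uℕ (suc j)) (uℕ (suc (i ℕ.+ j)))
             (uℕ (suc (i ℕ.+ n))) (uℕ (suc (j ℕ.+ n)))
             (uℕ (suc (i ℕ.+ j ℕ.+ n))) (uℕ (suc (suc (i ℕ.+ j ℕ.+ n)))))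

    vℕ≈2uℕ₊₁-puℕ : ∀ n → vℕ n ≈ (1# + 1#) * uℕ (suc n) - p * uℕ n
    vℕ≈2uℕ₊₁-puℕ zero          = solve 1 (λ p → :1 :+ :1 := (:1 :+ :1) :* :1 :- p :* :0) refl p
    vℕ≈2uℕ₊₁-puℕ (suc zero)    = solve 2 (λ p q → p := (:1 :+ :1) :* (p :* :1 :- q :* :0) :- p :* :1) refl p q
    vℕ≈2uℕ₊₁-puℕ (suc (suc n)) = linear-combination
      (p · vℕ≈2uℕ₊₁-puℕ (suc n) ∷ - q · vℕ≈2uℕ₊₁-puℕ n ∷ [])
      (solve 6 (λ p q vₙ vₙ₊₁ uₙ uₙ₊₁ →
          p :* vₙ₊₁ :- q :* vₙ
            :- ((:1 :+ :1) :* (p :* (p :* uₙ₊₁ :- q :* uₙ) :- q :* uₙ₊₁) :- p :* (p :* uₙ₊₁ :- q :* uₙ))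
          := p :* (vₙ₊₁ :- ((:1 :+ :1) :* (p :* uₙ₊₁ :- q :* uₙ) :- p :* uₙ₊₁))
             :+ ((:- q) :* (vₙ :- ((:1 :+ :1) :* uₙ₊₁ :- p :* uₙ)) :+ :0))
        refl p q (vℕ n) (vℕ (suc n)) (uℕ n) (uℕ (suc n)))

    vℕ-product : ProductFormula vℕ D
    vℕ-product n i j = begin
      vℕ (i ℕ.+ n) * vℕ (j ℕ.+ n) - powℕ q n * (vℕ i * vℕ j)
        ≈⟨ +-cong (*-cong (v≈ (i ℕ.+ n)) (v≈ (j ℕ.+ n))) (-‿cong (*-congˡ (*-cong (v≈ i) (v≈ j)))) ⟩
      (2u (suc (i ℕ.+ n)) - p * uℕ (i ℕ.+ n)) * (2u (suc (j ℕ.+ n)) - p * uℕ (j ℕ.+ n))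
        - powℕ q n * ((2u (suc i) - p * uℕ i) * (2u (suc j) - p * uℕ j))
        ≈⟨ linear-combination
             ( (1# + 1#) * (1# + 1#) · reindex n (≡.cong (λ k → suc (k ℕ.+ n)) (ℕP.+-suc i j)) (uℕ-product n (suc i) (suc j))
             ∷ - ((1# + 1#) * p) · uℕ-product n (suc i) j
             ∷ - ((1# + 1#) * p) · reindex n (≡.cong (ℕ._+ n) (ℕP.+-suc i j)) (uℕ-product n i (suc j))
             ∷ p * p · uℕ-product n i j
             ∷ [])
             (solve 14 (λ p q qⁿ uₙ a₀ a₁ b₀ b₁ c₀ c₁ d₀ d₁ w₀ w₁ →
                let two = :1 :+ :1 ; w₂ = p :* w₁ :- q :* w₀ in
                (two :* a₁ :- p :* a₀) :* (two :* b₁ :- p :* b₀)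
                  :- qⁿ :* ((two :* c₁ :- p :* c₀) :* (two :* d₁ :- p :* d₀))
                  :- (p :* p :- (:1 :+ :1 :+ :1 :+ :1) :* q) :* (uₙ :* w₀)
                := two :* two :* (a₁ :* b₁ :- qⁿ :* (c₁ :* d₁) :- :1 :* (uₙ :* w₂))
                   :+ ((:- (two :* p)) :* (a₁ :* b₀ :- qⁿ :* (c₁ :* d₀) :- :1 :* (uₙ :* w₁))
                   :+ ((:- (two :* p)) :* (a₀ :* b₁ :- qⁿ :* (c₀ :* d₁) :- :1 :* (uₙ :* w₁))
                   :+ (p :* p :* (a₀ :* b₀ :- qⁿ :* (c₀ :* d₀) :- :1 :* (uₙ :* w₀)) :+ :0))))
               refl p q (powℕ q n) (uℕ n) (uℕ (i ℕ.+ n)) (uℕ (suc (i ℕ.+ n))) (uℕ (j ℕ.+ n)) (uℕ (suc (j ℕ.+ n)))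
                    (uℕ i) (uℕ (suc i)) (uℕ j) (uℕ (suc j)) (uℕ (i ℕ.+ j ℕ.+ n)) (uℕ (suc (i ℕ.+ j ℕ.+ n)))) ⟩
      D * (uℕ n * uℕ (i ℕ.+ j ℕ.+ n)) ∎
      where
      2u : ℕ → Carrier
      2u k = (1# + 1#) * uℕ k
      v≈ = vℕ≈2uℕ₊₁-puℕ

    module _ (q≉0 : q ≉ 0#) where

      u-neg : ∀ z → u (ℤ.- z) ≈ - (powℤ q (ℤ.- z) * u z)
      u-neg (+ zero)  = solve 0 (:0 := :- (:1 :* :0)) refl
      u-neg (+ suc n) = -‿cong (trans (*-comm _ _) (*-congʳ (sym (pow-⁻¹ q≉0 (suc n)))))
      u-neg -[1+ n ]  = linear-combination
        (- uℕ (suc n) · x*x⁻¹≈1 (pow-≉0 q≉0 (suc n)) ∷ [])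
        (solve 3 (λ uₙ qⁿ qⁿ′ → uₙ :- :- (qⁿ :* :- (uₙ :* qⁿ′)) := (:- uₙ) :* (qⁿ :* qⁿ′ :- :1) :+ :0)
          refl (uℕ (suc n)) (powℕ q (suc n)) (powℕ q (suc n) ⁻¹))

      v-neg : ∀ z → v (ℤ.- z) ≈ powℤ q (ℤ.- z) * v z
      v-neg (+ zero)  = sym (*-identityˡ _)
      v-neg (+ suc n) = trans (*-comm _ _) (*-congʳ (sym (pow-⁻¹ q≉0 (suc n))))
      v-neg -[1+ n ]  = linear-combination
        (- vℕ (suc n) · x*x⁻¹≈1 (pow-≉0 q≉0 (suc n)) ∷ [])
        (solve 3 (λ vₙ qⁿ qⁿ′ → vₙ :- qⁿ :* (vₙ :* qⁿ′) := (:- vₙ) :* (qⁿ :* qⁿ′ :- :1) :+ :0)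
          refl (vℕ (suc n)) (powℕ q (suc n)) (powℕ q (suc n) ⁻¹))

      sq-u-neg : ∀ z → sq (u (ℤ.- z)) ≈ powℤ q (ℤ.- z) * powℤ q (ℤ.- z) * sq (u z)
      sq-u-neg z = trans (*-cong (u-neg z) (u-neg z))
        (solve 2 (λ r x → (:- (r :* x)) :* (:- (r :* x)) := r :* r :* (x :* x)) refl (powℤ q (ℤ.- z)) (u z))

      sq-v-neg : ∀ z → sq (v (ℤ.- z)) ≈ powℤ q (ℤ.- z) * powℤ q (ℤ.- z) * sq (v z)
      sq-v-neg z = trans (*-cong (v-neg z) (v-neg z))
        (solve 2 (λ r x → r :* x :* (r :* x) := r :* r :* (x :* x)) refl (powℤ q (ℤ.- z)) (v z))

    module _ (W : ℤ → Carrier) (κ : Carrier) (W-product : ProductFormula (λ n → W (+ n)) κ)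
             (sq-W-neg : q ≉ 0# → ∀ z → sq (W (ℤ.- z)) ≈ powℤ q (ℤ.- z) * powℤ q (ℤ.- z) * sq (W z))
             where

      CatalanIdentity : ℤ → ℤ → Set ℓ
      CatalanIdentity a b =
        κ * (powℤ q a * u (b ℤ.- a) * u (b ℤ.+ a)) ≈ powℤ q a * sq (W b) - powℤ q b * sq (W a)

      catalan-ℕ : ∀ {A B} → A ℕ.≤ B → CatalanIdentity (+ A) (+ B)
      catalan-ℕ {A} A≤B with k , ≡.refl ← ℕP.m≤n⇒∃[o]m+o≡n A≤B
        rewrite +[m+n]-+m≡+n A k | ℕP.+-comm (A ℕ.+ k) A | ≡.sym (ℕP.+-assoc A A k) = linear-combination
        ( - powℤ q (+ A) · W-product k A A
        ∷ sq (W (+ A)) · pow-+ q A k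
        ∷ [])
        (solve 8 (λ κ qᴬ qᵏ qᴬ⁺ᵏ uₖ u′ Wᴬ Wᴮ →
            κ :* (qᴬ :* uₖ :* u′) :- (qᴬ :* Wᴮ :- qᴬ⁺ᵏ :* Wᴬ)
            := (:- qᴬ) :* (Wᴮ :- qᵏ :* Wᴬ :- κ :* (uₖ :* u′)) :+ (Wᴬ :* (qᴬ⁺ᵏ :- qᴬ :* qᵏ) :+ :0))
          refl κ (powℕ q A) (powℕ q k) (powℕ q (A ℕ.+ k)) (uℕ k) (uℕ (A ℕ.+ A ℕ.+ k))
               (sq (W (+ A))) (sq (W (+ (A ℕ.+ k)))))

      module _ (q≉0 : q ≉ 0#) where

        catalan-swap : ∀ {a b} → CatalanIdentity a b → CatalanIdentity b a
        catalan-swap {a} {b} cat rewrite ℤP.+-comm a b = linear-combination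
          ( κ * powℤ q b * u (b ℤ.+ a) · u[a-b]
          ∷ κ * u (b ℤ.- a) * u (b ℤ.+ a) · qᵃ
          ∷ - 1# · cat
          ∷ [])
          (solve 9 (λ κ qᵃ qᵇ q⁻ X U V Wᵃ Wᵇ →
              κ :* (qᵇ :* X :* V) :- (qᵇ :* Wᵃ :- qᵃ :* Wᵇ)
              := κ :* qᵇ :* V :* (X :- :- (q⁻ :* U))
                 :+ (κ :* U :* V :* (qᵃ :- qᵇ :* q⁻)
                 :+ ((:- :1) :* (κ :* (qᵃ :* U :* V) :- (qᵃ :* Wᵇ :- qᵇ :* Wᵃ)) :+ :0)))
            refl κ (powℤ q a) (powℤ q b) (powℤ q (ℤ.- (b ℤ.- a))) (u (a ℤ.- b)) (u (b ℤ.- a)) (u (b ℤ.+ a))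
                 (sq (W a)) (sq (W b)))
          where
          a-b≡-[b-a] : ∀ a b → a ℤ.- b ≡ ℤ.- (b ℤ.- a)
          a-b≡-[b-a] = ℤ-Solver.solve-∀
          b-[b-a]≡a : ∀ a b → b ℤ.+ ℤ.- (b ℤ.- a) ≡ a
          b-[b-a]≡a = ℤ-Solver.solve-∀
          u[a-b] : u (a ℤ.- b) ≈ - (powℤ q (ℤ.- (b ℤ.- a)) * u (b ℤ.- a))
          u[a-b] = trans (reflexive (≡.cong u (a-b≡-[b-a] a b))) (u-neg q≉0 (b ℤ.- a))
          qᵃ : powℤ q a ≈ powℤ q b * powℤ q (ℤ.- (b ℤ.- a))
          qᵃ = trans (reflexive (≡.cong (powℤ q) (≡.sym (b-[b-a]≡a a b)))) (powℤ-+ q≉0 b (ℤ.- (b ℤ.- a)))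

        catalan-negˡ : ∀ {a b} → CatalanIdentity a b → CatalanIdentity (ℤ.- a) b
        catalan-negˡ {a} {b} cat = linear-combination
          ( κ * q⁻ᵃ * u (b ℤ.- a) · reflexive (≡.cong (λ c → u (b ℤ.+ c)) (ℤP.neg-involutive a))
          ∷ powℤ q b · sq-W-neg q≉0 a
          ∷ q⁻ᵃ * q⁻ᵃ · cat
          ∷ - ((κ * u (b ℤ.- a) * u (b ℤ.+ a) - sq (W b)) * q⁻ᵃ) · powℤ-inverseˡ q≉0 a
          ∷ [])
          (solve 10 (λ κ q⁻ᵃ qᵃ qᵇ X U V Wᵃ Wᵇ W⁻ᵃ →
              κ :* (q⁻ᵃ :* X :* U) :- (q⁻ᵃ :* Wᵇ :- qᵇ :* W⁻ᵃ)
              := κ :* q⁻ᵃ :* U :* (X :- V)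
                 :+ (qᵇ :* (W⁻ᵃ :- q⁻ᵃ :* q⁻ᵃ :* Wᵃ)
                 :+ (q⁻ᵃ :* q⁻ᵃ :* (κ :* (qᵃ :* U :* V) :- (qᵃ :* Wᵇ :- qᵇ :* Wᵃ))
                 :+ ((:- ((κ :* U :* V :- Wᵇ) :* q⁻ᵃ)) :* (q⁻ᵃ :* qᵃ :- :1) :+ :0))))
            refl κ q⁻ᵃ (powℤ q a) (powℤ q b) (u (b ℤ.- ℤ.- a)) (u (b ℤ.- a)) (u (b ℤ.+ a))
                 (sq (W a)) (sq (W b)) (sq (W (ℤ.- a))))
          where
          q⁻ᵃ = powℤ q (ℤ.- a)

        catalan-negʳ : ∀ {a b} → CatalanIdentity a b → CatalanIdentity a (ℤ.- b)
        catalan-negʳ {a} {b} cat = linear-combination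
          ( κ * powℤ q a * u (ℤ.- b ℤ.+ a) · u[-b-a]
          ∷ - (κ * powℤ q a * r₁ * u (b ℤ.+ a)) · u[-b+a]
          ∷ κ * powℤ q a * u (b ℤ.- a) * u (b ℤ.+ a) · r₁r₂
          ∷ - powℤ q a · sq-W-neg q≉0 b
          ∷ q⁻ᵇ * q⁻ᵇ · cat
          ∷ - (q⁻ᵇ * sq (W a)) · powℤ-inverseˡ q≉0 b
          ∷ [])
          (solve 13 (λ κ qᵃ qᵇ q⁻ᵇ r₁ r₂ X Y U V Wᵃ Wᵇ W⁻ᵇ →
              κ :* (qᵃ :* X :* Y) :- (qᵃ :* W⁻ᵇ :- q⁻ᵇ :* Wᵃ)
              := κ :* qᵃ :* Y :* (X :- :- (r₁ :* V))
                 :+ ((:- (κ :* qᵃ :* r₁ :* V)) :* (Y :- :- (r₂ :* U))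
                 :+ (κ :* qᵃ :* U :* V :* (r₁ :* r₂ :- q⁻ᵇ :* q⁻ᵇ)
                 :+ ((:- qᵃ) :* (W⁻ᵇ :- q⁻ᵇ :* q⁻ᵇ :* Wᵇ)
                 :+ (q⁻ᵇ :* q⁻ᵇ :* (κ :* (qᵃ :* U :* V) :- (qᵃ :* Wᵇ :- qᵇ :* Wᵃ))
                 :+ ((:- (q⁻ᵇ :* Wᵃ)) :* (q⁻ᵇ :* qᵇ :- :1) :+ :0))))))
            refl κ (powℤ q a) (powℤ q b) q⁻ᵇ r₁ r₂ (u (ℤ.- b ℤ.- a)) (u (ℤ.- b ℤ.+ a))
                 (u (b ℤ.- a)) (u (b ℤ.+ a)) (sq (W a)) (sq (W b)) (sq (W (ℤ.- b))))
          where
          q⁻ᵇ = powℤ q (ℤ.- b)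
          r₁  = powℤ q (ℤ.- (b ℤ.+ a))
          r₂  = powℤ q (ℤ.- (b ℤ.- a))
          -b+a≡-[b-a] : ∀ a b → ℤ.- b ℤ.+ a ≡ ℤ.- (b ℤ.- a)
          -b+a≡-[b-a] = ℤ-Solver.solve-∀
          -[b+a]-[b-a]≡-b-b : ∀ a b → ℤ.- (b ℤ.+ a) ℤ.+ ℤ.- (b ℤ.- a) ≡ ℤ.- b ℤ.+ ℤ.- b
          -[b+a]-[b-a]≡-b-b = ℤ-Solver.solve-∀
          u[-b-a] : u (ℤ.- b ℤ.- a) ≈ - (r₁ * u (b ℤ.+ a))
          u[-b-a] = trans (reflexive (≡.cong u (≡.sym (ℤP.neg-distrib-+ b a)))) (u-neg q≉0 (b ℤ.+ a))
          u[-b+a] : u (ℤ.- b ℤ.+ a) ≈ - (r₂ * u (b ℤ.- a))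
          u[-b+a] = trans (reflexive (≡.cong u (-b+a≡-[b-a] a b))) (u-neg q≉0 (b ℤ.- a))
          r₁r₂ : r₁ * r₂ ≈ q⁻ᵇ * q⁻ᵇ
          r₁r₂ = begin
            r₁ * r₂                                    ≈⟨ powℤ-+ q≉0 (ℤ.- (b ℤ.+ a)) (ℤ.- (b ℤ.- a)) ⟨
            powℤ q (ℤ.- (b ℤ.+ a) ℤ.+ ℤ.- (b ℤ.- a))  ≡⟨ ≡.cong (powℤ q) (-[b+a]-[b-a]≡-b-b a b) ⟩
            powℤ q (ℤ.- b ℤ.+ ℤ.- b)                  ≈⟨ powℤ-+ q≉0 (ℤ.- b) (ℤ.- b) ⟩
            q⁻ᵇ * q⁻ᵇ                                  ∎

        catalan-pos : ∀ A B → CatalanIdentity (+ A) (+ B)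
        catalan-pos A B with ℕP.≤-total A B
        ... | inj₁ A≤B = catalan-ℕ A≤B
        ... | inj₂ B≤A = catalan-swap (catalan-ℕ B≤A)

        catalan-ℤ : ∀ a b → CatalanIdentity a b
        catalan-ℤ (+ A)    (+ B)    = catalan-pos A B
        catalan-ℤ (+ A)    -[1+ n ] = catalan-negʳ (catalan-pos A (suc n))
        catalan-ℤ -[1+ m ] (+ B)    = catalan-negˡ (catalan-pos (suc m) B)
        catalan-ℤ -[1+ m ] -[1+ n ] = catalan-negˡ (catalan-negʳ (catalan-pos (suc m) (suc n)))

      catalan : ∀ {a b} → q ≉ 0# ⊎ (+ 0 ℤ.≤ a × a ℤ.≤ b) → CatalanIdentity a b
      catalan {a} {b} (inj₁ q≉0)                    = catalan-ℤ q≉0 a b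
      catalan         (inj₂ (ℤ.+≤+ _ , ℤ.+≤+ A≤B)) = catalan-ℕ A≤B

      G : ℤ → Carrier
      G z = powℤ q z * sq (W z) ⁻¹

      term≈difference : κ ≉ 0# → ∀ s f K i → CatalanIdentity (f i) (f (i ℕ.+ K)) → den W f K i ≉ 0# →
        term W s f K i ≈ powℕ (sign s) i * (κ ⁻¹ * G (f i) - κ ⁻¹ * G (f (i ℕ.+ K)))
      term≈difference κ≉0 s f K i cat den≉0 = begin
        ε * qᵃ * U * V * den W f K i ⁻¹   ≈⟨ solve 5 (λ ε qᵃ U V d → ε :* qᵃ :* U :* V :* d := ε :* (qᵃ :* U :* V :* d))
                                               refl ε qᵃ U V (den W f K i ⁻¹) ⟩
        ε * (qᵃ * U * V * den W f K i ⁻¹) ≈⟨ *-congˡ (quotient-of-cross-difference cat κ≉0 den≉0) ⟩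
        ε * (κ ⁻¹ * G (f i) - κ ⁻¹ * G (f (i ℕ.+ K))) ∎
        where
        ε  = powℕ (sign s) i
        qᵃ = powℤ q (f i)
        U  = u (f (i ℕ.+ K) ℤ.- f i)
        V  = u (f (i ℕ.+ K) ℤ.+ f i)

      Σ1-term-swap : κ ≉ 0# → ∀ f M N →
        q ≉ 0# ⊎ (NonnegIndices f (2 ℕ.* M) (2 ℕ.* N) × NonnegIndices f (2 ℕ.* N) (2 ℕ.* M)) → ∀ s →
        DenomsNonzero W f (2 ℕ.* M) (2 ℕ.* N) → DenomsNonzero W f (2 ℕ.* N) (2 ℕ.* M) →
        Σ1 (2 ℕ.* N) (term W s f (2 ℕ.* M)) ≈ Σ1 (2 ℕ.* M) (term W s f (2 ℕ.* N))
      Σ1-term-swap κ≉0 f M N indices s dens₁ dens₂ = begin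
        Σ1 (2 ℕ.* N) (term W s f (2 ℕ.* M))                   ≈⟨ Σ1-cong (2 ℕ.* N) (term≈ (Sum.map₂ proj₁ indices) dens₁) ⟩
        Σ1 (2 ℕ.* N) (λ i → ε i * (g i - g (i ℕ.+ 2 ℕ.* M)))  ≈⟨ Σ1-swap ε g (2 ℕ.* M) (2 ℕ.* N) (sign-periodic s M) (sign-periodic s N) ⟩
        Σ1 (2 ℕ.* M) (λ i → ε i * (g i - g (i ℕ.+ 2 ℕ.* N)))  ≈⟨ Σ1-cong (2 ℕ.* M) (term≈ (Sum.map₂ proj₂ indices) dens₂) ⟨
        Σ1 (2 ℕ.* M) (term W s f (2 ℕ.* N))                   ∎
        where
        ε g : ℕ → Carrier
        ε = powℕ (sign s)
        g i = κ ⁻¹ * G (f i)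
        term≈ : ∀ {K n} → q ≉ 0# ⊎ NonnegIndices f K n → DenomsNonzero W f K n →
                ∀ i → 1 ℕ.≤ i → i ℕ.≤ n → term W s f K i ≈ ε i * (g i - g (i ℕ.+ K))
        term≈ indicesᴷ dens i 1≤i i≤n =
          term≈difference κ≉0 s f _ i (catalan (Sum.map₂ (λ nonneg → nonneg i 1≤i i≤n) indicesᴷ)) (dens i 1≤i i≤n)

theorem24 : ∀ {c ℓ} (F : Field c ℓ) (p q : Field.Carrier F) →
    let open Field F
        open Lucas F p q
    in ¬ (D ≈ 0#) →
       (f : ℕ → ℤ) (M N : ℕ) → 1 ≤ M → 1 ≤ N →
       (¬ (q ≈ 0#) ⊎ (NonnegIndices f (2 *ℕ M) (2 *ℕ N) × NonnegIndices f (2 *ℕ N) (2 *ℕ M))) →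
       (s : Bool) →
       ((DenomsNonzero u f (2 *ℕ M) (2 *ℕ N) → DenomsNonzero u f (2 *ℕ N) (2 *ℕ M) →
           Σ1 (2 *ℕ N) (term u s f (2 *ℕ M)) ≈ Σ1 (2 *ℕ M) (term u s f (2 *ℕ N)))
        ×
        (DenomsNonzero v f (2 *ℕ M) (2 *ℕ N) → DenomsNonzero v f (2 *ℕ N) (2 *ℕ M) →
           Σ1 (2 *ℕ N) (term v s f (2 *ℕ M)) ≈ Σ1 (2 *ℕ M) (term v s f (2 *ℕ N))))
theorem24 F p q D≉0 f M N _ _ indices s =
    Σ1-term-swap F p q u 1# (uℕ-product F p q) (sq-u-neg F p q) (1≉0 F) f M N indices s
  , Σ1-term-swap F p q v D (vℕ-product F p q) (sq-v-neg F p q) D≉0 f M N indices s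
  where
  open Field F
  open Lucas F p q
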